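{- Let $n\ge 3$ and $1\le a,r\le n-1$ be integers with $r^2\equiv -1\pmod n$ and $ra\equiv \pm a\pmod n$. Then $n$ is even, $a$ is odd, and $n=2a$. -}

module Defs where

-- From r² ≡ -1 and ra ≡ ±a (mod n) one gets n ∣ a(r² + 1) − (ra ∓ a)(r ± 1) = 2a,
-- and since 0 < 2a < 2n this forces n = 2a. Finally a is odd, for otherwise
-- 4 ∣ n ∣ r² + 1, while r² + 1 is never divisible by 4.
module Submission where

open import Defs
open import Data.Nat using (ℕ; _≤_; _<_; _*_)
open import Data.Nat.Divisibility using (_∣_)
open import Data.Integer using (ℤ; +_; _+_; _-_) renaming (_*_ to _*ℤ_)
open import Data.Integer.Divisibility using () renaming (_∣_ to _∣ℤ_)
open import Data.Product using (_×_)
open import Data.Sum using (_⊎_)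
open import Relation.Nullary using (¬_)
open import Relation.Binary.PropositionalEquality using (_≡_)

open import Data.Nat as ℕ using (zero; suc; z≤n; s≤s)
open import Data.Nat.Properties using (+-identityʳ; *-monoʳ-<; *-monoˡ-≤; ≤-<-trans; <-irrefl)
open import Data.Nat.Divisibility using (divides; ∣⇒≤; ∣-trans; ∣m+n∣m⇒∣n; n∣m*n; m∣m*n; *-monoʳ-∣)
import Data.Nat.Tactic.RingSolver as ℕ-Solver
open import Data.Integer using (1ℤ)
open import Data.Integer.Properties using (pos-*)
open import Data.Integer.Tactic.RingSolver using (solve-∀)
open import Data.Integer.Divisibility.Signed
  using (∣ᵤ⇒∣; ∣⇒∣ᵤ; ∣m∣n⇒∣m-n; ∣n⇒∣m*n; ∣m⇒∣m*n)
  renaming (_∣_ to _∣ₛ_)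
open import Data.Product using (_,_)
open import Data.Sum using (inj₁; inj₂)
import Data.Sum as Sum
open import Data.Empty using (⊥-elim)
open import Relation.Binary.PropositionalEquality using (refl; sym; trans; cong; subst)

4∤n*n+1 : ∀ n → ¬ (4 ∣ n * n ℕ.+ 1)
4∤n*n+1 zero          4∣1 with s≤s () ← ∣⇒≤ 4∣1
4∤n*n+1 (suc zero)    4∣2 with s≤s (s≤s ()) ← ∣⇒≤ 4∣2
4∤n*n+1 (suc (suc n)) 4∣[n+2]²+1 =
  4∤n*n+1 n (∣m+n∣m⇒∣n (subst (4 ∣_) (expand n) 4∣[n+2]²+1) (n∣m*n (suc n)))
  where
  expand : ∀ n → (2 ℕ.+ n) * (2 ℕ.+ n) ℕ.+ 1 ≡ (1 ℕ.+ n) * 4 ℕ.+ (n * n ℕ.+ 1)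
  expand = ℕ-Solver.solve-∀

m∣n∧0<n<2m⇒m≡n : ∀ {m n} → m ∣ n → 0 < n → n < 2 * m → m ≡ n
m∣n∧0<n<2m⇒m≡n (divides zero          refl)  ()
m∣n∧0<n<2m⇒m≡n (divides (suc zero)    n≡1*m) _ _ = sym (trans n≡1*m (+-identityʳ _))
m∣n∧0<n<2m⇒m≡n {m} (divides (suc (suc q)) refl) _ [q+2]m<2m =
  ⊥-elim (<-irrefl refl (≤-<-trans (*-monoˡ-≤ m {2} {2 ℕ.+ q} (s≤s (s≤s z≤n))) [q+2]m<2m))

∣r*r+1∧∣r*a∓a⇒∣a+a : ∀ {n} a r → n ∣ₛ r *ℤ r + 1ℤ →
  n ∣ₛ r *ℤ a - a ⊎ n ∣ₛ r *ℤ a + a → n ∣ₛ a + a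
∣r*r+1∧∣r*a∓a⇒∣a+a {n} a r n∣r²+1 (inj₁ n∣ra-a) =
  subst (n ∣ₛ_) (cancel-with-r+1 a r)
    (∣m∣n⇒∣m-n (∣n⇒∣m*n a n∣r²+1) (∣m⇒∣m*n (r + 1ℤ) n∣ra-a))
  where
  cancel-with-r+1 : ∀ a r → a *ℤ (r *ℤ r + 1ℤ) - (r *ℤ a - a) *ℤ (r + 1ℤ) ≡ a + a
  cancel-with-r+1 = solve-∀
∣r*r+1∧∣r*a∓a⇒∣a+a {n} a r n∣r²+1 (inj₂ n∣ra+a) =
  subst (n ∣ₛ_) (cancel-with-r-1 a r)
    (∣m∣n⇒∣m-n (∣n⇒∣m*n a n∣r²+1) (∣m⇒∣m*n (r - 1ℤ) n∣ra+a))
  where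
  cancel-with-r-1 : ∀ a r → a *ℤ (r *ℤ r + 1ℤ) - (r *ℤ a + a) *ℤ (r - 1ℤ) ≡ a + a
  cancel-with-r-1 = solve-∀

mainTheorem3 : (n a r : ℕ) → 3 ≤ n → 1 ≤ a → 1 ≤ r → a < n → r < n →
    (+ n) ∣ℤ ((+ r) *ℤ (+ r) + + 1) →
    ((+ n) ∣ℤ ((+ r) *ℤ (+ a) - + a) ⊎ (+ n) ∣ℤ ((+ r) *ℤ (+ a) + + a)) →
    (2 ∣ n) × (¬ (2 ∣ a)) × (n ≡ 2 * a)
mainTheorem3 n a@(suc _) r _ _ _ a<n _ n∣r²+1 n∣ra∓a = 2∣n , a-odd , n≡2a
  where
  n∣2a : n ∣ 2 * a
  n∣2a = subst (n ∣_) (cong (a ℕ.+_) (sym (+-identityʳ a)))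
    (∣⇒∣ᵤ (∣r*r+1∧∣r*a∓a⇒∣a+a (+ a) (+ r) (∣ᵤ⇒∣ {+ n} n∣r²+1)
      (Sum.map (∣ᵤ⇒∣ {+ n}) (∣ᵤ⇒∣ {+ n}) n∣ra∓a)))

  n≡2a : n ≡ 2 * a
  n≡2a = m∣n∧0<n<2m⇒m≡n n∣2a (s≤s z≤n) (*-monoʳ-< 2 a<n)

  2∣n : 2 ∣ n
  2∣n = subst (2 ∣_) (sym n≡2a) (m∣m*n a)

  n∣r*r+1 : n ∣ r * r ℕ.+ 1
  n∣r*r+1 = subst (λ x → n ∣ Data.Integer.∣ x + 1ℤ ∣) (sym (pos-* r r)) n∣r²+1

  a-odd : ¬ (2 ∣ a)
  a-odd 2∣a = 4∤n*n+1 r (∣-trans (subst (4 ∣_) (sym n≡2a) (*-monoʳ-∣ 2 2∣a)) n∣r*r+1)
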